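{- Let $U$ be a union-by-size union-find structure (without path compression) on $n$ vertices, obtained by any sequence of union operations, and let $A$ be a minibatch of $b$ edges. Then $\textsc{Simple-Bulk-Update}(U,A)$ takes $O(b\log n)$ work and $O(\log n)$ depth.
   Context: Model: work-depth model on a CRCW PRAM. Union-find structure $U$ (union by size, no path compression): arrays $\mathrm{parent}$ and $\mathrm{size}$ of length $n$; initially $\mathrm{parent}[u]=u$, $\mathrm{size}[u]=1$. A vertex $u$ is a root iff $\mathrm{parent}[u]=u$. $U.\mathrm{find}(u)$ follows parent pointers from $u$ to a root and returns it. $U.\mathrm{union}(u,v)$ for distinct roots makes the root of the smaller tree point to the other root, updates sizes, and returns the surviving root. $\mathrm{CC}$: a parallel connected-components routine (e.g. Gazit's algorithm) that, given a list of edges $E$ on vertices $V'$, returns the connected components of the resulting graph using $O(|V'|+|E|)$ work and $O(\log|V'|)$ depth. $\textsc{Parallel-Join}(U,C)$, for a sequence $C$ of distinct roots: if $|C|=1$ return $C[1]$; otherwise with $\ell=\lfloor |C|/2\rfloor$, compute in parallel $u:=\textsc{Parallel-Join}(U,C[1..\ell])$ and $v:=\textsc{Parallel-Join}(U,C[\ell+1..|C|])$, then return $U.\mathrm{union}(u,v)$. $\textsc{Simple-Bulk-Update}(U,A)$: (1) form $A'=\langle (U.\mathrm{find}(u),U.\mathrm{find}(v)) : (u,v)\in A\rangle$ with all finds in parallel; (2) let $A''$ be $A'$ with pairs $(x,x)$ removed (parallel filter); (3) compute $\mathcal{C}=\mathrm{CC}(A'')$; (4) in parallel for each $C\in\mathcal{C}$,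 run $\textsc{Parallel-Join}(U,C)$. -}

module Defs where

open import Data.Nat using (ℕ; zero; suc; _+_; _*_; _⊔_; _≤_; ⌊_/2⌋)
open import Data.Nat.Logarithm using (⌈log₂_⌉)
open import Data.Fin using (Fin; _≟_)
open import Data.Bool using (if_then_else_)
open import Data.Maybe using (Maybe; just; nothing)
open import Data.Product using (_×_; _,_; proj₁; proj₂; Σ; ∃-syntax)
open import Data.Sum using (_⊎_)
open import Data.List using (List; []; _∷_; map; length; filter; take; drop; concatMap; deduplicate; foldr)
open import Data.List.Membership.Propositional using (_∈_)
open import Data.List.Relation.Unary.Any using (Any)
open import Data.List.Relation.Unary.All using (All)
open import Data.List.Relation.Unary.Unique.Propositional using (Unique)
open import Relation.Binary.PropositionalEquality using (_≡_; _≢_)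
open import Relation.Binary.Construct.Closure.ReflexiveTransitive using (Star)
open import Relation.Nullary using (¬_; does)
open import Relation.Nullary.Decidable using (⌊_⌋)

record Cost : Set where
  constructor ⟨_,_⟩
  field
    work  : ℕ
    depth : ℕ
open Cost public

unit : Cost
unit = ⟨ 1 , 1 ⟩

infixr 5 _⊕_
_⊕_ : Cost → Cost → Cost
⟨ w₁ , d₁ ⟩ ⊕ ⟨ w₂ , d₂ ⟩ = ⟨ w₁ + w₂ , d₁ + d₂ ⟩

-- parallel composition of two tasks (one fork/join step)
infixr 6 _∥_
_∥_ : Cost → Cost → Cost
⟨ w₁ , d₁ ⟩ ∥ ⟨ w₂ , d₂ ⟩ = ⟨ 1 + w₁ + w₂ , 1 + (d₁ ⊔ d₂) ⟩

-- parallel for-loop over a list of tasks (PRAM: O(1) spawn per task)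
pfor : List Cost → Cost
pfor cs = ⟨ length cs + foldr (λ c s → work c + s) 0 cs
          , 1 + foldr (λ c s → depth c ⊔ s) 0 cs ⟩

-- parallel filter (via prefix sums) on m items: O(m) work, O(log m) depth
filterCost : ℕ → Cost
filterCost m = ⟨ 1 + m , 1 + ⌈log₂ m ⌉ ⟩

record UF (n : ℕ) : Set where
  constructor mkUF
  field
    parent : Fin n → Fin n
    size   : Fin n → ℕ
open UF public

initUF : (n : ℕ) → UF n
initUF n = mkUF (λ u → u) (λ _ → 1)

IsRoot : ∀ {n} → UF n → Fin n → Set
IsRoot U u = parent U u ≡ u

update : ∀ {n} {A : Set} → (Fin n → A) → Fin n → A → Fin n → A
update f i x j = if does (j ≟ i) then x else f j

-- U.union(u,v) for distinct roots: root of smaller tree points to the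
-- other root; sizes updated; returns (new structure, surviving root).
-- (On a tie, v is attached below u; since union(v,u) is also a union
-- operation, both tie orientations are covered by Reachable.)
union : ∀ {n} → UF n → Fin n → Fin n → UF n × Fin n
union U u v =
  if does (size U u Data.Nat.<? size U v)
  then (mkUF (update (parent U) u v) (update (size U) v (size U u + size U v)) , v)
  else (mkUF (update (parent U) v u) (update (size U) u (size U u + size U v)) , u)

data Reachable {n : ℕ} : UF n → Set where
  init : Reachable (initUF n)
  step : ∀ {U u v} → Reachable U → IsRoot U u → IsRoot U v → u ≢ v →
         Reachable (proj₁ (union U u v))

-- find with fuel: returns (root, cost). Cost = 1 + number of parent
-- pointers followed. Fuel n suffices since trees have < n edges.
findF : ∀ {n} → ℕ → UF n → Fin n → Fin n × ℕ
findF zero    U u = u , 1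
findF (suc k) U u with does (parent U u ≟ u)
... | Data.Bool.true  = u , 1
... | Data.Bool.false with findF k U (parent U u)
...   | r , c = r , suc c

find : ∀ {n} → UF n → Fin n → Fin n × ℕ
find {n} U u = findF n U u

-- Parallel-Join (fuel = length of C suffices)

pjoinF : ∀ {n} → ℕ → UF n → List (Fin n) → UF n × Maybe (Fin n) × Cost
pjoinF zero    U _             = U , nothing , unit
pjoinF (suc f) U []            = U , nothing , unit
pjoinF (suc f) U (x ∷ [])      = U , just x , unit
pjoinF (suc f) U C@(_ ∷ _ ∷ _) with pjoinF f U (take ⌊ length C /2⌋ C)
... | U₁ , mu , c₁ with pjoinF f U₁ (drop ⌊ length C /2⌋ C)
...   | U₂ , mv , c₂ with mu | mv
...     | just u | just v = proj₁ (union U₂ u v) , just (proj₂ (union U₂ u v)) , ((c₁ ∥ c₂) ⊕ unit)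
...     | _      | _      = U₂ , nothing , ((c₁ ∥ c₂) ⊕ unit)

parallelJoin : ∀ {n} → UF n → List (Fin n) → UF n × Maybe (Fin n) × Cost
parallelJoin U C = pjoinF (length C) U C

-- run Parallel-Join on each component (components are disjoint, so the
-- joins touch disjoint trees; we thread the state sequentially but
-- charge parallel cost).
joinAll : ∀ {n} → UF n → List (List (Fin n)) → UF n × List Cost
joinAll U []       = U , []
joinAll U (C ∷ Cs) with parallelJoin U C
... | U₁ , _ , c with joinAll U₁ Cs
...   | U₂ , cs = U₂ , (c ∷ cs)

Edge : ℕ → Set
Edge n = Fin n × Fin n

Endpoint : ∀ {n} → List (Edge n) → Fin n → Set
Endpoint E u = Any (λ e → proj₁ e ≡ u ⊎ proj₂ e ≡ u) E

Adj : ∀ {n} → List (Edge n) → Fin n → Fin n → Set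
Adj E u v = (u , v) ∈ E ⊎ (v , u) ∈ E

Connected : ∀ {n} → List (Edge n) → Fin n → Fin n → Set
Connected E = Star (Adj E)

vertices : ∀ {n} → List (Edge n) → List (Fin n)
vertices E = deduplicate _≟_ (concatMap (λ e → proj₁ e ∷ proj₂ e ∷ []) E)

IsComponents : ∀ {n} → List (Edge n) → List (List (Fin n)) → Set
IsComponents {n} E Cs =
    All (λ C → Unique C × C ≢ []) Cs
  × (∀ C → C ∈ Cs → ∀ u → u ∈ C → Endpoint E u)
  × (∀ u → Endpoint E u → Any (u ∈_) Cs)
  × (∀ u (p q : Any (u ∈_) Cs) → Data.List.Relation.Unary.Any.index p ≡ Data.List.Relation.Unary.Any.index q)
  × (∀ C → C ∈ Cs → ∀ u v → u ∈ C → v ∈ C → Connected E u v)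
  × (∀ C → C ∈ Cs → ∀ u v → u ∈ C → Connected E u v → v ∈ C)

CCAlg : Set
CCAlg = ∀ {n} → List (Edge n) → List (List (Fin n)) × Cost

CCSpec : ℕ → CCAlg → Set
CCSpec k cc = ∀ {n} (E : List (Edge n)) →
    IsComponents E (proj₁ (cc E))
  × work  (proj₂ (cc E)) ≤ k * (length (vertices E) + length E)
  × depth (proj₂ (cc E)) ≤ k * (1 + ⌈log₂ (length (vertices E)) ⌉)

notLoop : ∀ {n} → Edge n → Data.Bool.Bool
notLoop (x , y) = Data.Bool.not (does (x ≟ y))

simpleBulkUpdate : ∀ {n} → CCAlg → UF n → List (Edge n) → UF n × Cost
simpleBulkUpdate {n} cc U A =
  let
      A'    = map (λ e → proj₁ (find U (proj₁ e)) , proj₁ (find U (proj₂ e))) A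
      cost₁ = pfor (map (λ e → ⟨ proj₂ (find U (proj₁ e)) , proj₂ (find U (proj₁ e)) ⟩
                             ∥ ⟨ proj₂ (find U (proj₂ e)) , proj₂ (find U (proj₂ e)) ⟩) A)
      A''   = filter (λ e → Data.Bool.T? (notLoop e)) A'
      cost₂ = filterCost (length A')
      Cs    = proj₁ (cc A'')
      cost₃ = proj₂ (cc A'')
      res   = joinAll U Cs
      cost₄ = pfor (proj₂ res)
  in proj₁ res , (cost₁ ⊕ cost₂ ⊕ cost₃ ⊕ cost₄)

-- Union by size keeps two invariants: a non-root has at most half the size of its
-- parent, and the sizes of the roots sum to n.  So a find from u follows at most
-- ⌈log₂ n⌉ pointers, and the b finds cost O(b log n) work and O(log n) depth.  The
-- remaining phases are linear in b: the filtered edge list has at most b edges and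
-- 2b endpoints, its components are disjoint lists of those endpoints, and
-- Parallel-Join on a component C is a balanced tree of unions with work O(|C|) and
-- depth O(log |C|) ≤ O(log n).  As there are at most n² distinct edges, the depth
-- O(log b) of the filter is O(log n) as well.

module Submission where

open import Defs
open import Data.Nat using (ℕ; zero; suc; _+_; _*_; _^_; _≤_; _<ᵇ_; _∸_; s≤s⁻¹; _⊔_; ⌊_/2⌋; ⌈_/2⌉; z≤n; s≤s; >-nonZero; >-nonZero⁻¹)
open import Data.Nat.Properties hiding (_≟_)
open import Data.Nat.Logarithm using (⌈log₂_⌉; ⌈log₂⌉-mono-≤; ⌈log₂2^n⌉≡n; ⌈log₂2*n⌉≡1+⌈log₂n⌉; ⌈log₂⌈n/2⌉⌉≡⌈log₂n⌉∸1)
open import Data.Fin using (Fin; _≟_; punchIn; combine)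
open import Data.Fin.Properties using (punchInᵢ≢i; nonZeroIndex; combine-injective) renaming (suc-injective to Fin-suc-injective; 0≢1+n to Fin-0≢1+n)
open import Data.Bool using (true; false; T; T?; if_then_else_)
open import Data.Empty using (⊥-elim)
open import Data.Maybe using (just; nothing)
open import Data.Product using (_×_; _,_; proj₁; proj₂; uncurry; ∃-syntax)
open import Data.Sum using (inj₁; inj₂)
open import Data.List using (List; []; _∷_; length; map; take; drop; concat; concatMap; filter)
open import Data.List.Properties using (length-map; length-filter; length-tabulate; length-++; length-take; length-drop; take++drop≡id)
open import Data.List.Membership.Propositional using (_∈_)
open import Data.List.Membership.Propositional.Properties using (∈-allFin; ∈-concat⁻; ∈-concat⁻′; ∈-deduplicate⁻)
open import Data.List.Relation.Unary.Any using (Any; here; there; index; _─_)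
open import Data.List.Relation.Unary.All using (All; []; _∷_) renaming (lookup to All-lookup; map to All-map; universal to All-universal)
open import Data.List.Relation.Unary.All.Properties using () renaming (map⁺ to All-map⁺)
open import Data.List.Relation.Unary.AllPairs using (_∷_)
open import Data.List.Relation.Unary.Unique.Propositional using (Unique; [])
open import Data.List.Relation.Unary.Unique.Propositional.Properties using (map⁺; ++⁺)
open import Data.List.Relation.Unary.Unique.DecPropositional.Properties using (deduplicate-!)
open import Data.List.Relation.Binary.Subset.Propositional using (_⊆_)
open import Data.Nat.Tactic.RingSolver using (solve-∀)
open import Function using (_∘_; case_of_)
open import Relation.Binary.PropositionalEquality
open import Relation.Nullary using (¬_; yes; no; does)
open import Algebra.Properties.CommutativeSemigroup *-commutativeSemigroup
  using () renaming (x∙yz≈y∙xz to x*yz≡y*xz)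
open import Algebra.Properties.CommutativeMonoid.Sum +-0-commutativeMonoid
  using (sum; sum-remove; ∑-distrib-+; sum-cong-≗; sum-replicate-zero)

private
  variable
    n : ℕ

update-≡ : ∀ {A : Set} (f : Fin n → A) i a → update f i a i ≡ a
update-≡ f i a with i ≟ i
... | yes _ = refl
... | no i≢i = ⊥-elim (i≢i refl)

update-≢ : ∀ {A : Set} (f : Fin n → A) i a {j} → j ≢ i → update f i a j ≡ f j
update-≢ f i a {j} j≢i with j ≟ i
... | yes j≡i = ⊥-elim (j≢i j≡i)
... | no _ = refl

≤-sum : (t : Fin n → ℕ) (i : Fin n) → t i ≤ sum t
≤-sum {suc _} t i = ≤-trans (m≤m+n (t i) _) (≤-reflexive (sym (sum-remove {i = i} t)))

sum-indicator : (i : Fin n) (c : ℕ) → sum (update (λ _ → 0) i c) ≡ c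
sum-indicator {suc n} i c = begin
  sum t                               ≡⟨ sum-remove {i = i} t ⟩
  t i + sum (t ∘ punchIn i)           ≡⟨ cong₂ _+_ (update-≡ _ i c) (sum-cong-≗ (λ j → update-≢ _ i c (punchInᵢ≢i i j))) ⟩
  c + sum {n} (λ _ → 0)               ≡⟨ cong (c +_) (sum-replicate-zero n) ⟩
  c + 0                               ≡⟨ +-identityʳ c ⟩
  c                                   ∎
  where
  open ≡-Reasoning
  t = update (λ _ → 0) i c

sum-ones : ∀ n → sum {n} (λ _ → 1) ≡ n
sum-ones zero = refl
sum-ones (suc n) = cong suc (sum-ones n)

rootSize : UF n → Fin n → ℕ
rootSize U w = if does (parent U w ≟ w) then size U w else 0

rootSize-root : (U : UF n) {w : Fin n} → IsRoot U w → rootSize U w ≡ size U w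
rootSize-root U {w} root with parent U w ≟ w
... | yes _ = refl
... | no nonroot = ⊥-elim (nonroot root)

rootSize-nonroot : (U : UF n) {w : Fin n} → ¬ IsRoot U w → rootSize U w ≡ 0
rootSize-nonroot U {w} nonroot with parent U w ≟ w
... | yes root = ⊥-elim (nonroot root)
... | no _ = refl

record SizeInvariant (U : UF n) : Set where
  field
    size-positive : ∀ w → 1 ≤ size U w
    size-bounded  : ∀ w → size U w ≤ n
    size-doubles  : ∀ w → ¬ IsRoot U w → 2 * size U w ≤ size U (parent U w)
    rootSize-sum  : sum (rootSize U) ≡ n

initUF-sizeInvariant : ∀ n → SizeInvariant (initUF n)
initUF-sizeInvariant n = record
  { size-positive = λ _ → ≤-refl
  ; size-bounded  = λ w → >-nonZero⁻¹ n {{nonZeroIndex w}}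
  ; size-doubles  = λ w nonroot → ⊥-elim (nonroot refl)
  ; rootSize-sum  = trans (sum-cong-≗ (λ w → rootSize-root (initUF n) {w} refl)) (sum-ones n)
  }

-- The new size s is a parameter because union writes it as size u + size v in both orientations.
attach : UF n → Fin n → Fin n → ℕ → UF n
attach U x y s = mkUF (update (parent U) x y) (update (size U) y s)

module _ {U : UF n} (I : SizeInvariant U) {x y : Fin n}
         (root-x : IsRoot U x) (root-y : IsRoot U y) (x≢y : x ≢ y)
         (sx≤sy : size U x ≤ size U y) {s : ℕ} (s≡ : s ≡ size U x + size U y) where

  open SizeInvariant I
  private
    U′ = attach U x y s
    y≢x : y ≢ x
    y≢x = x≢y ∘ sym

  size-attach-y : size U′ y ≡ size U x + size U y
  size-attach-y = trans (update-≡ (size U) y s) s≡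

  size-attach-≢y : ∀ {w} → w ≢ y → size U′ w ≡ size U w
  size-attach-≢y = update-≢ (size U) y s

  size-attach-mono : ∀ w → size U w ≤ size U′ w
  size-attach-mono w = case w ≟ y of λ where
    (yes refl) → ≤-trans (m≤n+m (size U y) (size U x)) (≤-reflexive (sym size-attach-y))
    (no w≢y)   → ≤-reflexive (sym (size-attach-≢y w≢y))

  x-nonroot-attach : ¬ IsRoot U′ x
  x-nonroot-attach root = x≢y (trans (sym root) (update-≡ (parent U) x y))

  parent-attach-≢x : ∀ {w} → w ≢ x → parent U′ w ≡ parent U w
  parent-attach-≢x = update-≢ (parent U) x y

  y-root-attach : IsRoot U′ y
  y-root-attach = trans (parent-attach-≢x y≢x) root-y

  rootSize-attach-≢ : ∀ {w} → w ≢ x → w ≢ y → rootSize U′ w ≡ rootSize U w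
  rootSize-attach-≢ w≢x w≢y rewrite parent-attach-≢x w≢x | size-attach-≢y w≢y = refl

  rootSize-attach-x : rootSize U′ x + size U x ≡ rootSize U x + 0
  rootSize-attach-x = begin
    rootSize U′ x + size U x  ≡⟨ cong (_+ size U x) (rootSize-nonroot U′ x-nonroot-attach) ⟩
    size U x                  ≡⟨ sym (rootSize-root U root-x) ⟩
    rootSize U x              ≡⟨ sym (+-identityʳ _) ⟩
    rootSize U x + 0          ∎
    where open ≡-Reasoning

  rootSize-attach-y : rootSize U′ y + 0 ≡ rootSize U y + size U x
  rootSize-attach-y = begin
    rootSize U′ y + 0         ≡⟨ +-identityʳ _ ⟩
    rootSize U′ y             ≡⟨ rootSize-root U′ y-root-attach ⟩
    size U′ y                 ≡⟨ size-attach-y ⟩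
    size U x + size U y       ≡⟨ +-comm (size U x) _ ⟩
    size U y + size U x       ≡⟨ cong (_+ size U x) (sym (rootSize-root U root-y)) ⟩
    rootSize U y + size U x   ∎
    where open ≡-Reasoning

  -- Attaching x moves the contribution size U x from the root x to the root y.
  rootSize-attach : ∀ w → rootSize U′ w + update (λ _ → 0) x (size U x) w
                        ≡ rootSize U w + update (λ _ → 0) y (size U x) w
  rootSize-attach w = case w ≟ x of λ where
    (yes refl) → subst₂ (λ a b → rootSize U′ x + a ≡ rootSize U x + b)
                   (sym (update-≡ _ x _)) (sym (update-≢ _ y _ x≢y)) rootSize-attach-x
    (no w≢x) → case w ≟ y of λ where
      (yes refl) → subst₂ (λ a b → rootSize U′ y + a ≡ rootSize U y + b)
                     (sym (update-≢ _ x _ y≢x)) (sym (update-≡ _ y _)) rootSize-attach-y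
      (no w≢y) → cong₂ _+_ (rootSize-attach-≢ w≢x w≢y)
                           (trans (update-≢ _ x _ w≢x) (sym (update-≢ _ y _ w≢y)))

  rootSize-sum-attach : sum (rootSize U′) ≡ n
  rootSize-sum-attach = +-cancelʳ-≡ _ _ _ (begin
    sum (rootSize U′) + size U x
      ≡⟨ cong (sum (rootSize U′) +_) (sym (sum-indicator x (size U x))) ⟩
    sum (rootSize U′) + sum (update (λ _ → 0) x (size U x))
      ≡⟨ sym (∑-distrib-+ (rootSize U′) _) ⟩
    sum (λ w → rootSize U′ w + update (λ _ → 0) x (size U x) w)
      ≡⟨ sum-cong-≗ rootSize-attach ⟩
    sum (λ w → rootSize U w + update (λ _ → 0) y (size U x) w)
      ≡⟨ ∑-distrib-+ (rootSize U) _ ⟩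
    sum (rootSize U) + sum (update (λ _ → 0) y (size U x))
      ≡⟨ cong₂ _+_ rootSize-sum (sum-indicator y (size U x)) ⟩
    n + size U x ∎)
    where open ≡-Reasoning

  size-bounded-attach : ∀ w → size U′ w ≤ n
  size-bounded-attach w = case w ≟ y of λ where
    (yes refl) → subst₂ _≤_ (rootSize-root U′ y-root-attach) rootSize-sum-attach
                   (≤-sum (rootSize U′) y)
    (no w≢y) → subst (_≤ n) (sym (size-attach-≢y w≢y)) (size-bounded w)

  size-doubles-attach-x : 2 * size U′ x ≤ size U′ (parent U′ x)
  size-doubles-attach-x = begin
    2 * size U′ x            ≡⟨ cong (2 *_) (size-attach-≢y x≢y) ⟩
    2 * size U x             ≡⟨ cong (size U x +_) (+-identityʳ _) ⟩
    size U x + size U x      ≤⟨ +-monoʳ-≤ (size U x) sx≤sy ⟩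
    size U x + size U y      ≡⟨ sym size-attach-y ⟩
    size U′ y                ≡⟨ cong (size U′) (sym (update-≡ (parent U) x y)) ⟩
    size U′ (parent U′ x)    ∎
    where open ≤-Reasoning

  size-doubles-attach-≢x : ∀ {w} → w ≢ x → ¬ IsRoot U′ w → 2 * size U′ w ≤ size U′ (parent U′ w)
  size-doubles-attach-≢x {w} w≢x nonroot′ = begin
    2 * size U′ w            ≡⟨ cong (2 *_) (size-attach-≢y w≢y) ⟩
    2 * size U w             ≤⟨ size-doubles w nonroot ⟩
    size U (parent U w)      ≤⟨ size-attach-mono (parent U w) ⟩
    size U′ (parent U w)     ≡⟨ cong (size U′) (sym (parent-attach-≢x w≢x)) ⟩
    size U′ (parent U′ w)    ∎
    where
    open ≤-Reasoning
    nonroot : ¬ IsRoot U w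
    nonroot root = nonroot′ (trans (parent-attach-≢x w≢x) root)
    w≢y : w ≢ y
    w≢y refl = nonroot root-y

  sizeInvariant-attach : SizeInvariant U′
  sizeInvariant-attach = record
    { size-positive = λ w → ≤-trans (size-positive w) (size-attach-mono w)
    ; size-bounded  = size-bounded-attach
    ; size-doubles  = λ w → case w ≟ x of λ where
        (yes refl) → λ _ → size-doubles-attach-x
        (no w≢x)   → size-doubles-attach-≢x w≢x
    ; rootSize-sum  = rootSize-sum-attach
    }

-- union tests does (size U u <? size U v), which computes to size U u <ᵇ size U v.
sizeInvariant-union : {U : UF n} {u v : Fin n} → SizeInvariant U → IsRoot U u → IsRoot U v → u ≢ v →
                      SizeInvariant (proj₁ (union U u v))
sizeInvariant-union {U = U} {u} {v} I root-u root-v u≢v with size U u <ᵇ size U v in su<ᵇsv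
... | true  = sizeInvariant-attach I root-u root-v u≢v
                (<⇒≤ (<ᵇ⇒< (size U u) _ (subst T (sym su<ᵇsv) _))) refl
... | false = sizeInvariant-attach I root-v root-u (u≢v ∘ sym)
                (≮⇒≥ (λ su<sv → subst T su<ᵇsv (<⇒<ᵇ su<sv))) (+-comm (size U u) _)

reachable⇒sizeInvariant : {U : UF n} → Reachable U → SizeInvariant U
reachable⇒sizeInvariant init = initUF-sizeInvariant _
reachable⇒sizeInvariant (step R root-u root-v u≢v) =
  sizeInvariant-union (reachable⇒sizeInvariant R) root-u root-v u≢v

-- Each pointer followed at least doubles the size, which never exceeds n.
findF-cost-doubling : {U : UF n} → SizeInvariant U →
                      ∀ k u → 2 ^ proj₂ (findF k U u) * size U u ≤ 2 * n
findF-cost-doubling I zero u = *-monoʳ-≤ 2 (SizeInvariant.size-bounded I u)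
findF-cost-doubling {n} {U} I (suc k) u with parent U u ≟ u
... | yes _ = *-monoʳ-≤ 2 (SizeInvariant.size-bounded I u)
... | no nonroot with findF k U (parent U u) | findF-cost-doubling I k (parent U u)
...   | _ , c | ih = begin
  2 * 2 ^ c * size U u      ≡⟨ cong (_* size U u) (*-comm 2 (2 ^ c)) ⟩
  2 ^ c * 2 * size U u      ≡⟨ *-assoc (2 ^ c) 2 _ ⟩
  2 ^ c * (2 * size U u)    ≤⟨ *-monoʳ-≤ (2 ^ c) (SizeInvariant.size-doubles I u nonroot) ⟩
  2 ^ c * size U (parent U u) ≤⟨ ih ⟩
  2 * n                     ∎
  where open ≤-Reasoning

find-cost : {U : UF n} → SizeInvariant U → ∀ u → proj₂ (find U u) ≤ suc ⌈log₂ n ⌉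
find-cost {n} {U} I u = begin
  c                  ≡⟨ ⌈log₂2^n⌉≡n c ⟨
  ⌈log₂ (2 ^ c) ⌉    ≤⟨ ⌈log₂⌉-mono-≤ 2^c≤2n ⟩
  ⌈log₂ (2 * n) ⌉    ≡⟨ ⌈log₂2*n⌉≡1+⌈log₂n⌉ n {{nonZeroIndex u}} ⟩
  suc ⌈log₂ n ⌉      ∎
  where
  open ≤-Reasoning
  c = proj₂ (find U u)
  2^c≤2n : 2 ^ c ≤ 2 * n
  2^c≤2n = ≤-trans (m≤m*n (2 ^ c) (size U u) {{>-nonZero (SizeInvariant.size-positive I u)}}) (findF-cost-doubling I n u)

∈-─ : ∀ {A : Set} {x z : A} (ys : List A) (x∈ys : x ∈ ys) → z ∈ ys → z ≢ x → z ∈ (ys ─ x∈ys)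
∈-─ (_ ∷ _)  (here refl) (here refl) z≢x = ⊥-elim (z≢x refl)
∈-─ (_ ∷ _)  (here refl) (there z∈)  _   = z∈
∈-─ (_ ∷ _)  (there _)   (here refl) _   = here refl
∈-─ (_ ∷ ys) (there x∈)  (there z∈)  z≢x = there (∈-─ ys x∈ z∈ z≢x)

length-─ : ∀ {A : Set} {x : A} (ys : List A) (x∈ys : x ∈ ys) → suc (length (ys ─ x∈ys)) ≡ length ys
length-─ (_ ∷ _)  (here _)   = refl
length-─ (_ ∷ ys) (there x∈) = cong suc (length-─ ys x∈)

Unique∧⊆⇒length≤ : ∀ {A : Set} {xs ys : List A} → Unique xs → xs ⊆ ys → length xs ≤ length ys
Unique∧⊆⇒length≤ [] _ = z≤n
Unique∧⊆⇒length≤ {xs = x ∷ xs} {ys} (x∉xs ∷ xs!) x∷xs⊆ys = begin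
  suc (length xs)               ≤⟨ s≤s (Unique∧⊆⇒length≤ xs! xs⊆ys─x) ⟩
  suc (length (ys ─ x∈ys))      ≡⟨ length-─ ys x∈ys ⟩
  length ys                     ∎
  where
  open ≤-Reasoning
  x∈ys = x∷xs⊆ys (here refl)
  xs⊆ys─x : xs ⊆ (ys ─ x∈ys)
  xs⊆ys─x z∈xs = ∈-─ ys x∈ys (x∷xs⊆ys (there z∈xs)) (λ { refl → All-lookup x∉xs z∈xs refl })

Unique-Fin⇒length≤ : {xs : List (Fin n)} → Unique xs → length xs ≤ n
Unique-Fin⇒length≤ {n} {xs} xs! =
  subst (length xs ≤_) (length-tabulate {n = n} (λ i → i)) (Unique∧⊆⇒length≤ xs! (λ {i} _ → ∈-allFin i))

Unique-Fin²⇒length≤ : {xs : List (Fin n × Fin n)} → Unique xs → length xs ≤ n * n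
Unique-Fin²⇒length≤ {xs = xs} xs! = subst (_≤ _) (length-map (uncurry combine) xs)
  (Unique-Fin⇒length≤ (map⁺ combine-injective′ xs!))
  where
  combine-injective′ : ∀ {p q} → uncurry combine p ≡ uncurry combine q → p ≡ q
  combine-injective′ {i , j} {k , l} eq with combine-injective i j k l eq
  ... | refl , refl = refl

2≤⇒1≤⌈log₂⌉ : ∀ {m} → 2 ≤ m → 1 ≤ ⌈log₂ m ⌉
2≤⇒1≤⌈log₂⌉ = ⌈log₂⌉-mono-≤ {2}

⌈log₂⌈/2⌉⌉≤ : ∀ {m L} → ⌈log₂ m ⌉ ≤ suc L → ⌈log₂ ⌈ m /2⌉ ⌉ ≤ L
⌈log₂⌈/2⌉⌉≤ {m} h = subst (_≤ _) (sym (⌈log₂⌈n/2⌉⌉≡⌈log₂n⌉∸1 m)) (∸-monoˡ-≤ 1 h)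

⌈log₂⌉≤⇒≤2^ : ∀ L m → ⌈log₂ m ⌉ ≤ L → m ≤ 2 ^ L
⌈log₂⌉≤⇒≤2^ L       zero          _ = z≤n
⌈log₂⌉≤⇒≤2^ L       (suc zero)    _ = m^n>0 2 L
⌈log₂⌉≤⇒≤2^ zero    (suc (suc m)) h = ⊥-elim (<⇒≱ (2≤⇒1≤⌈log₂⌉ (s≤s (s≤s (z≤n {m})))) h)
⌈log₂⌉≤⇒≤2^ (suc L) m@(suc (suc _)) h = begin
  m                       ≡⟨ ⌊n/2⌋+⌈n/2⌉≡n m ⟨
  ⌊ m /2⌋ + ⌈ m /2⌉       ≤⟨ +-monoˡ-≤ ⌈ m /2⌉ (⌊n/2⌋≤⌈n/2⌉ m) ⟩
  ⌈ m /2⌉ + ⌈ m /2⌉       ≤⟨ +-mono-≤ half≤ half≤ ⟩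
  2 ^ L + 2 ^ L           ≡⟨ cong (2 ^ L +_) (+-identityʳ (2 ^ L)) ⟨
  2 ^ suc L               ∎
  where
  open ≤-Reasoning
  half≤ : ⌈ m /2⌉ ≤ 2 ^ L
  half≤ = ⌈log₂⌉≤⇒≤2^ L ⌈ m /2⌉ (⌈log₂⌈/2⌉⌉≤ {m} h)

⌈log₂[n*n]⌉≤ : ∀ n → ⌈log₂ (n * n) ⌉ ≤ 2 * ⌈log₂ n ⌉
⌈log₂[n*n]⌉≤ n = begin
  ⌈log₂ (n * n) ⌉          ≤⟨ ⌈log₂⌉-mono-≤ (*-mono-≤ n≤2^L n≤2^L) ⟩
  ⌈log₂ (2 ^ L * 2 ^ L) ⌉  ≡⟨ cong ⌈log₂_⌉ (^-distribˡ-+-* 2 L L) ⟨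
  ⌈log₂ (2 ^ (L + L)) ⌉    ≡⟨ ⌈log₂2^n⌉≡n (L + L) ⟩
  L + L                    ≡⟨ cong (L +_) (+-identityʳ L) ⟨
  2 * L                    ∎
  where
  open ≤-Reasoning
  L = ⌈log₂ n ⌉
  n≤2^L : n ≤ 2 ^ L
  n≤2^L = ⌈log₂⌉≤⇒≤2^ L n ≤-refl

joinCost : ℕ → UF n → List (Fin n) → Cost
joinCost f U C = proj₂ (proj₂ (pjoinF f U C))

module _ {A : Set} (C : List A) where

  private
    h = ⌊ length C /2⌋

  length-take+drop-half : length (take h C) + length (drop h C) ≡ length C
  length-take+drop-half = trans (sym (length-++ (take h C))) (cong length (take++drop≡id h C))

  length-take-half : length (take h C) ≤ ⌈ length C /2⌉
  length-take-half = ≤-trans (≤-reflexive (length-take h C)) (≤-trans (m⊓n≤m _ _) (⌊n/2⌋≤⌈n/2⌉ (length C)))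

  length-drop-half : length (drop h C) ≡ ⌈ length C /2⌉
  length-drop-half = trans (length-drop h C)
    (trans (cong (_∸ h) (sym (⌊n/2⌋+⌈n/2⌉≡n (length C)))) (m+n∸m≡n h _))

pjoinF-cost-split : ∀ f (U : UF n) x y r →
  let C = x ∷ y ∷ r ; h = ⌊ length C /2⌋ in
  joinCost (suc f) U C ≡ (joinCost f U (take h C) ∥ joinCost f (proj₁ (pjoinF f U (take h C))) (drop h C)) ⊕ unit
pjoinF-cost-split f U x y r with pjoinF f U (take ⌊ length (x ∷ y ∷ r) /2⌋ (x ∷ y ∷ r))
... | U₁ , mu , c₁ with pjoinF f U₁ (drop ⌊ length (x ∷ y ∷ r) /2⌋ (x ∷ y ∷ r))
...   | U₂ , mv , c₂ with mu | mv
...     | just _  | just _  = refl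
...     | just _  | nothing = refl
...     | nothing | _       = refl

-- The slack 3 makes the bound 4|C| − 3 add up over the two halves.
joinCost-work : ∀ f (U : UF n) C → 1 ≤ length C → work (joinCost f U C) + 3 ≤ 4 * length C
joinCost-work zero    U C           1≤|C| = *-monoʳ-≤ 4 1≤|C|
joinCost-work (suc f) U (x ∷ [])    _     = ≤-refl
joinCost-work (suc f) U C@(x ∷ y ∷ r) _ rewrite pjoinF-cost-split f U x y r = begin
  1 + w₁ + w₂ + 1 + 3        ≤⟨ m≤m+n _ 1 ⟩
  1 + w₁ + w₂ + 1 + 3 + 1    ≡⟨ rearrange w₁ w₂ ⟩
  (w₁ + 3) + (w₂ + 3)        ≤⟨ +-mono-≤ (joinCost-work f U (take h C) (s≤s z≤n))
                                         (joinCost-work f U₁ (drop h C) 1≤|drop|) ⟩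
  4 * |take| + 4 * |drop|    ≡⟨ *-distribˡ-+ 4 |take| |drop| ⟨
  4 * (|take| + |drop|)      ≡⟨ cong (4 *_) (length-take+drop-half C) ⟩
  4 * length C               ∎
  where
  open ≤-Reasoning
  h = ⌊ length C /2⌋
  U₁ = proj₁ (pjoinF f U (take h C))
  w₁ = work (joinCost f U (take h C))
  w₂ = work (joinCost f U₁ (drop h C))
  |take| = length (take h C)
  |drop| = length (drop h C)
  1≤|drop| : 1 ≤ |drop|
  1≤|drop| = subst (1 ≤_) (sym (length-drop-half C)) (s≤s z≤n)
  rearrange : ∀ a b → 1 + a + b + 1 + 3 + 1 ≡ (a + 3) + (b + 3)
  rearrange = solve-∀

joinCost-depth : ∀ f (U : UF n) C L → ⌈log₂ (length C) ⌉ ≤ L → depth (joinCost f U C) ≤ 1 + 2 * L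
joinCost-depth zero    U C          L _ = s≤s z≤n
joinCost-depth (suc f) U []         L _ = s≤s z≤n
joinCost-depth (suc f) U (x ∷ [])   L _ = s≤s z≤n
joinCost-depth (suc f) U (x ∷ y ∷ r) zero log|C|≤ =
  ⊥-elim (<⇒≱ (2≤⇒1≤⌈log₂⌉ (s≤s (s≤s (z≤n {length r})))) log|C|≤)
joinCost-depth (suc f) U C@(x ∷ y ∷ r) (suc L) log|C|≤ rewrite pjoinF-cost-split f U x y r = begin
  1 + (d₁ ⊔ d₂) + 1          ≤⟨ +-monoˡ-≤ 1 (s≤s (⊔-lub (halfDepth (take h C) (length-take-half C))
                                                          (halfDepth (drop h C) (≤-reflexive (length-drop-half C))))) ⟩
  1 + (1 + 2 * L) + 1        ≡⟨ rearrange L ⟩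
  1 + 2 * suc L              ∎
  where
  open ≤-Reasoning
  h = ⌊ length C /2⌋
  U₁ = proj₁ (pjoinF f U (take h C))
  d₁ = depth (joinCost f U (take h C))
  d₂ = depth (joinCost f U₁ (drop h C))
  halfDepth : ∀ {V} D → length D ≤ ⌈ length C /2⌉ → depth (joinCost f V D) ≤ 1 + 2 * L
  halfDepth D |D|≤ = joinCost-depth f _ D L (≤-trans (⌈log₂⌉-mono-≤ |D|≤) (⌈log₂⌈/2⌉⌉≤ {length C} log|C|≤))
  rearrange : ∀ L → 1 + (1 + 2 * L) + 1 ≡ 1 + 2 * suc L
  rearrange = solve-∀

pfor-work-∷ : ∀ c cs → work (pfor (c ∷ cs)) ≡ suc (work c + work (pfor cs))
pfor-work-∷ c cs = rearrange (length cs) (work c) _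
  where
  rearrange : ∀ l w s → suc l + (w + s) ≡ suc (w + (l + s))
  rearrange = solve-∀

pfor-work-≤ : ∀ {K cs} → All (λ c → work c ≤ K) cs → work (pfor cs) ≤ length cs * suc K
pfor-work-≤ [] = z≤n
pfor-work-≤ {K} {c ∷ cs} (wc≤K ∷ ws≤K) =
  subst (_≤ length (c ∷ cs) * suc K) (sym (pfor-work-∷ c cs)) (s≤s (+-mono-≤ wc≤K (pfor-work-≤ ws≤K)))

pfor-depth-≤ : ∀ {K cs} → All (λ c → depth c ≤ K) cs → depth (pfor cs) ≤ suc K
pfor-depth-≤ [] = s≤s z≤n
pfor-depth-≤ (dc≤K ∷ ds≤K) = s≤s (⊔-lub dc≤K (s≤s⁻¹ (pfor-depth-≤ ds≤K)))

joinAll-work : (U : UF n) (Cs : List (List (Fin n))) → All (λ C → 1 ≤ length C) Cs →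
               work (pfor (proj₂ (joinAll U Cs))) ≤ 4 * length (concat Cs)
joinAll-work U [] [] = z≤n
joinAll-work U (C ∷ Cs) (1≤|C| ∷ 1≤|Cs|) with parallelJoin U C | joinCost-work (length C) U C 1≤|C|
... | U₁ , _ , c | wc with joinAll U₁ Cs | joinAll-work U₁ Cs 1≤|Cs|
...   | _ , cs | ih = begin
  work (pfor (c ∷ cs))                    ≡⟨ pfor-work-∷ c cs ⟩
  suc (work c + work (pfor cs))           ≤⟨ +-monoˡ-≤ (work (pfor cs)) (m<m+n (work c) (s≤s z≤n)) ⟩
  work c + 3 + work (pfor cs)             ≤⟨ +-mono-≤ wc ih ⟩
  4 * length C + 4 * length (concat Cs)   ≡⟨ *-distribˡ-+ 4 (length C) _ ⟨
  4 * (length C + length (concat Cs))     ≡⟨ cong (4 *_) (length-++ C) ⟨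
  4 * length (concat (C ∷ Cs))            ∎
  where open ≤-Reasoning

joinAll-depths : ∀ {L} (U : UF n) (Cs : List (List (Fin n))) → All (λ C → ⌈log₂ (length C) ⌉ ≤ L) Cs →
                 All (λ c → depth c ≤ 1 + 2 * L) (proj₂ (joinAll U Cs))
joinAll-depths U [] [] = []
joinAll-depths {L = L} U (C ∷ Cs) (logC≤ ∷ logCs≤) with parallelJoin U C | joinCost-depth (length C) U C L logC≤
... | U₁ , _ , c | dc with joinAll U₁ Cs | joinAll-depths U₁ Cs logCs≤
...   | _ , cs | ih = dc ∷ ih

endpoints : List (Edge n) → List (Fin n)
endpoints = concatMap (λ e → proj₁ e ∷ proj₂ e ∷ [])

length-endpoints : (E : List (Edge n)) → length (endpoints E) ≡ 2 * length E
length-endpoints []      = refl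
length-endpoints (_ ∷ E) = cong suc (trans (cong suc (length-endpoints E)) (sym (+-suc (length E) _)))

Endpoint⇒∈endpoints : ∀ (E : List (Edge n)) {u} → Endpoint E u → u ∈ endpoints E
Endpoint⇒∈endpoints (_ ∷ _) (here (inj₁ refl)) = here refl
Endpoint⇒∈endpoints (_ ∷ _) (here (inj₂ refl)) = there (here refl)
Endpoint⇒∈endpoints (_ ∷ E) (there u∈E)        = there (there (Endpoint⇒∈endpoints E u∈E))

vertices-unique : (E : List (Edge n)) → Unique (vertices E)
vertices-unique E = deduplicate-! _≟_ (endpoints E)

length-vertices≤ : (E : List (Edge n)) → length (vertices E) ≤ 2 * length E
length-vertices≤ E = subst (length (vertices E) ≤_) (length-endpoints E)
  (Unique∧⊆⇒length≤ (vertices-unique E) (∈-deduplicate⁻ _≟_ (endpoints E)))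

Unique-concat : ∀ {A : Set} (Cs : List (List A)) → All Unique Cs →
                (∀ u (p q : Any (u ∈_) Cs) → index p ≡ index q) → Unique (concat Cs)
Unique-concat []       []           _        = []
Unique-concat (C ∷ Cs) (C! ∷ Cs!) unique-index =
  ++⁺ C! (Unique-concat Cs Cs! (λ u p q → Fin-suc-injective (unique-index u (there p) (there q))))
      (λ (u∈C , u∈Cs) → Fin-0≢1+n (unique-index _ (here u∈C) (there (∈-concat⁻ Cs u∈Cs))))

module _ {E : List (Edge n)} {Cs : List (List (Fin n))} (comp : IsComponents E Cs) where

  private
    unique-nonempty = proj₁ comp
    ⊆-endpoints     = proj₁ (proj₂ comp)
    unique-index    = proj₁ (proj₂ (proj₂ (proj₂ comp)))

  components-nonempty : All (λ C → 1 ≤ length C) Cs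
  components-nonempty = All-map nonempty unique-nonempty
    where
    nonempty : ∀ {C : List (Fin n)} → Unique C × C ≢ [] → 1 ≤ length C
    nonempty {[]}    (_ , C≢[]) = ⊥-elim (C≢[] refl)
    nonempty {_ ∷ _} _          = s≤s z≤n

  components-log≤ : All (λ C → ⌈log₂ (length C) ⌉ ≤ ⌈log₂ n ⌉) Cs
  components-log≤ = All-map (λ (C! , _) → ⌈log₂⌉-mono-≤ (Unique-Fin⇒length≤ C!)) unique-nonempty

  length-concat-components≤ : length (concat Cs) ≤ 2 * length E
  length-concat-components≤ = subst (length (concat Cs) ≤_) (length-endpoints E)
    (Unique∧⊆⇒length≤ (Unique-concat Cs (All-map proj₁ unique-nonempty) unique-index) ⊆endpoints)
    where
    ⊆endpoints : concat Cs ⊆ endpoints E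
    ⊆endpoints u∈Cs with C , u∈C , C∈Cs ← ∈-concat⁻′ Cs u∈Cs =
      Endpoint⇒∈endpoints E (⊆-endpoints C C∈Cs _ u∈C)

≤*-absorb : ∀ {L} c d → 1 ≤ L → c + d * L ≤ (c + d) * L
≤*-absorb {L} c d 1≤L = begin
  c + d * L        ≤⟨ +-monoˡ-≤ (d * L) (subst (_≤ c * L) (*-identityʳ c) (*-monoʳ-≤ c 1≤L)) ⟩
  c * L + d * L    ≡⟨ *-distribʳ-+ L c d ⟨
  (c + d) * L      ∎
  where open ≤-Reasoning

+-mono-≤-* : ∀ {a b c d} p q r s X → a ≤ p * X → b ≤ q * X → c ≤ r * X → d ≤ s * X →
             a + (b + (c + d)) ≤ (p + (q + (r + s))) * X
+-mono-≤-* p q r s X a≤ b≤ c≤ d≤ =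
  ≤-trans (+-mono-≤ a≤ (+-mono-≤ b≤ (+-mono-≤ c≤ d≤))) (≤-reflexive (distrib p q r s X))
  where
  distrib : ∀ p q r s X → p * X + (q * X + (r * X + s * X)) ≡ (p + (q + (r + s))) * X
  distrib = solve-∀

findCost : UF n → Edge n → Cost
findCost U (u , v) = ⟨ proj₂ (find U u) , proj₂ (find U u) ⟩ ∥ ⟨ proj₂ (find U v) , proj₂ (find U v) ⟩

module BulkUpdateCost (k : ℕ) (cc : CCAlg) (spec : CCSpec k cc)
                      {n} (2≤n : 2 ≤ n) {U : UF n} (reach : Reachable U)
                      {A : List (Edge n)} (A! : Unique A) (1≤b : 1 ≤ length A) where

  private
    L = ⌈log₂ n ⌉
    b = length A
    X = b * L
    A′ = map (λ e → proj₁ (find U (proj₁ e)) , proj₁ (find U (proj₂ e))) A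
    A″ = filter (λ e → T? (notLoop e)) A′
    Cs = proj₁ (cc A″)
    comp = proj₁ (spec A″)

    1≤L : 1 ≤ L
    1≤L = 2≤⇒1≤⌈log₂⌉ 2≤n

    b≤X : b ≤ X
    b≤X = subst (_≤ X) (*-identityʳ b) (*-monoʳ-≤ b 1≤L)

    find≤ : ∀ u → proj₂ (find U u) ≤ suc L
    find≤ = find-cost (reachable⇒sizeInvariant reach)

    |A′|≡b : length A′ ≡ b
    |A′|≡b = length-map _ A

    |A″|≤b : length A″ ≤ b
    |A″|≤b = ≤-trans (length-filter _ A′) (≤-reflexive |A′|≡b)

    findCost-work : ∀ e → work (findCost U e) ≤ 3 + 2 * L
    findCost-work (u , v) = s≤s (≤-trans (+-mono-≤ (find≤ u) (find≤ v)) (≤-reflexive (twice L)))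
      where
      twice : ∀ L → suc L + suc L ≡ 2 + 2 * L
      twice = solve-∀

  finds-work : work (pfor (map (findCost U) A)) ≤ 6 * X
  finds-work = begin
    work (pfor (map (findCost U) A))  ≤⟨ pfor-work-≤ (All-map⁺ (All-universal findCost-work A)) ⟩
    length (map (findCost U) A) * (4 + 2 * L) ≡⟨ cong (_* (4 + 2 * L)) (length-map _ A) ⟩
    b * (4 + 2 * L)                   ≤⟨ *-monoʳ-≤ b (≤*-absorb 4 2 1≤L) ⟩
    b * (6 * L)                       ≡⟨ x*yz≡y*xz b 6 L ⟩
    6 * X                             ∎
    where open ≤-Reasoning

  finds-depth : depth (pfor (map (findCost U) A)) ≤ 4 * L
  finds-depth = ≤-trans (pfor-depth-≤ (All-map⁺ (All-universal findCost-depth A)))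
                        (subst (λ z → 3 + z ≤ 4 * L) (*-identityˡ L) (≤*-absorb 3 1 1≤L))
    where
    findCost-depth : ∀ e → depth (findCost U e) ≤ 2 + L
    findCost-depth (u , v) = s≤s (⊔-lub (find≤ u) (find≤ v))

  filter-work : work (filterCost (length A′)) ≤ 2 * X
  filter-work = begin
    1 + length A′    ≡⟨ cong suc |A′|≡b ⟩
    1 + b            ≤⟨ +-monoˡ-≤ b 1≤b ⟩
    b + b            ≤⟨ +-mono-≤ b≤X b≤X ⟩
    X + X            ≡⟨ cong (X +_) (+-identityʳ X) ⟨
    2 * X            ∎
    where open ≤-Reasoning

  filter-depth : depth (filterCost (length A′)) ≤ 3 * L
  filter-depth = begin
    1 + ⌈log₂ (length A′) ⌉   ≤⟨ s≤s (⌈log₂⌉-mono-≤ (subst (_≤ n * n) (sym |A′|≡b) (Unique-Fin²⇒length≤ A!))) ⟩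
    1 + ⌈log₂ (n * n) ⌉       ≤⟨ s≤s (⌈log₂[n*n]⌉≤ n) ⟩
    1 + 2 * L                 ≤⟨ ≤*-absorb 1 2 1≤L ⟩
    3 * L                     ∎
    where open ≤-Reasoning

  cc-work : work (proj₂ (cc A″)) ≤ (3 * k) * X
  cc-work = begin
    work (proj₂ (cc A″))                    ≤⟨ proj₁ (proj₂ (spec A″)) ⟩
    k * (length (vertices A″) + length A″)  ≤⟨ *-monoʳ-≤ k (+-monoˡ-≤ (length A″) (length-vertices≤ A″)) ⟩
    k * (2 * length A″ + length A″)         ≤⟨ *-monoʳ-≤ k (+-mono-≤ (*-monoʳ-≤ 2 |A″|≤X) |A″|≤X) ⟩
    k * (2 * X + X)                         ≡⟨ cong (k *_) (+-comm (2 * X) X) ⟩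
    k * (3 * X)                             ≡⟨ x*yz≡y*xz k 3 X ⟩
    3 * (k * X)                             ≡⟨ *-assoc 3 k X ⟨
    3 * k * X                               ∎
    where
    open ≤-Reasoning
    |A″|≤X = ≤-trans |A″|≤b b≤X

  cc-depth : depth (proj₂ (cc A″)) ≤ (2 * k) * L
  cc-depth = begin
    depth (proj₂ (cc A″))                   ≤⟨ proj₂ (proj₂ (spec A″)) ⟩
    k * (1 + ⌈log₂ (length (vertices A″)) ⌉) ≤⟨ *-monoʳ-≤ k (s≤s (⌈log₂⌉-mono-≤ (Unique-Fin⇒length≤ (vertices-unique A″)))) ⟩
    k * (1 + L)                             ≤⟨ *-monoʳ-≤ k (subst (λ z → 1 + z ≤ 2 * L) (*-identityˡ L) (≤*-absorb 1 1 1≤L)) ⟩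
    k * (2 * L)                             ≡⟨ x*yz≡y*xz k 2 L ⟩
    2 * (k * L)                             ≡⟨ *-assoc 2 k L ⟨
    2 * k * L                               ∎
    where open ≤-Reasoning

  joins-work : work (pfor (proj₂ (joinAll U Cs))) ≤ 8 * X
  joins-work = begin
    work (pfor (proj₂ (joinAll U Cs)))   ≤⟨ joinAll-work U Cs (components-nonempty comp) ⟩
    4 * length (concat Cs)               ≤⟨ *-monoʳ-≤ 4 (length-concat-components≤ comp) ⟩
    4 * (2 * length A″)                  ≤⟨ *-monoʳ-≤ 4 (*-monoʳ-≤ 2 (≤-trans |A″|≤b b≤X)) ⟩
    4 * (2 * X)                          ≡⟨ *-assoc 4 2 X ⟨
    8 * X                                ∎
    where open ≤-Reasoning

  joins-depth : depth (pfor (proj₂ (joinAll U Cs))) ≤ 4 * L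
  joins-depth = ≤-trans (pfor-depth-≤ (joinAll-depths U Cs (components-log≤ comp))) (≤*-absorb 2 2 1≤L)

  work-bound : work (proj₂ (simpleBulkUpdate cc U A)) ≤ (16 + 3 * k) * (length A * ⌈log₂ n ⌉)
  work-bound = subst (work (proj₂ (simpleBulkUpdate cc U A)) ≤_) (cong (_* X) (constant k))
    (+-mono-≤-* 6 2 (3 * k) 8 X finds-work filter-work cc-work joins-work)
    where
    constant : ∀ k → 6 + (2 + (3 * k + 8)) ≡ 16 + 3 * k
    constant = solve-∀

  depth-bound : depth (proj₂ (simpleBulkUpdate cc U A)) ≤ (16 + 3 * k) * ⌈log₂ n ⌉
  depth-bound = ≤-trans (+-mono-≤-* 4 3 (2 * k) 4 L finds-depth filter-depth cc-depth joins-depth)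
                        (*-monoˡ-≤ L (≤-trans (≤-reflexive (constant k)) (+-mono-≤ (m≤m+n 11 5) (*-monoˡ-≤ k (n≤1+n 2)))))
    where
    constant : ∀ k → 4 + (3 + (2 * k + 4)) ≡ 11 + 2 * k
    constant = solve-∀

lemma5 : (k : ℕ) → ∃[ c ] ((cc : CCAlg) → CCSpec k cc →
    (n : ℕ) → 2 ≤ n → (U : UF n) → Reachable U →
    (A : List (Edge n)) → Unique A → 1 ≤ length A →
    work (proj₂ (simpleBulkUpdate cc U A)) ≤ c * (length A * ⌈log₂ n ⌉)
    × depth (proj₂ (simpleBulkUpdate cc U A)) ≤ c * ⌈log₂ n ⌉)
lemma5 k = 16 + 3 * k , λ cc spec n 2≤n U reach A A! 1≤b →
  let open BulkUpdateCost k cc spec 2≤n reach A! 1≤b in work-bound , depth-bound
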